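{- Let $m,n$ be positive integers with $m<2^n$. Consider the following game. Kronecker holds a list of $m$ vectors $v_1,\ldots,v_m\in\{0,1\}^n$, unknown to Cantor. Cantor may ask queries of the form ``what is bit number $j$ of vector number $i$?'' (for $1\le i\le m$, $1\le j\le n$), which Kronecker answers truthfully; Cantor may choose each query adaptively, depending on the answers to previous queries. Cantor's goal is to output a vector $u\in\{0,1\}^n$ with $u\neq v_i$ for all $1\le i\le m$. Let $g(n,m)$ be the smallest number $q$ such that Cantor has an adaptive strategy that, for every list $v_1,\ldots,v_m$ of Kronecker, asks at most $q$ queries and then outputs such a vector $u$. Then \[ g(n,m)=\begin{cases} m & \text{if } m\le n,\\ 2m-n & \text{if } n<m<2^n.\end{cases} \] -}

module Defs where

open import Data.Nat using (ℕ; zero; suc; _≤_)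
open import Data.Bool using (Bool)
open import Data.Fin using (Fin)
open import Data.Vec using (Vec; lookup)
open import Data.Product using (Σ; _×_)
open import Relation.Binary.PropositionalEquality using (_≢_)

Instance : ℕ → ℕ → Set
Instance n m = Vec (Vec Bool n) m

-- An adaptive strategy for Cantor is a decision tree: either output a
-- vector u ∈ {0,1}ⁿ, or ask "bit j of vector i?" and continue depending
-- on the answer.
data Strategy (n m : ℕ) : Set where
  output : Vec Bool n → Strategy n m
  ask    : Fin m → Fin n → (Bool → Strategy n m) → Strategy n m

answer : ∀ {n m} → Instance n m → Fin m → Fin n → Bool
answer vs i j = lookup (lookup vs i) j

queries : ∀ {n m} → Strategy n m → Instance n m → ℕ
queries (output u)   vs = zero
queries (ask i j k)  vs = suc (queries (k (answer vs i j)) vs)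

result : ∀ {n m} → Strategy n m → Instance n m → Vec Bool n
result (output u)  vs = u
result (ask i j k) vs = result (k (answer vs i j)) vs

Wins : ∀ {n m} → ℕ → Strategy n m → Set
Wins {n} {m} q s = (vs : Instance n m) →
  (queries s vs ≤ q) × ((i : Fin m) → result s vs ≢ lookup vs i)

Solvable : ℕ → ℕ → ℕ → Set
Solvable n m q = Σ (Strategy n m) (Wins q)

IsG : ℕ → ℕ → ℕ → Set
IsG n m g = Solvable n m g × ((q : ℕ) → Solvable n m q → g ≤ q)

-- Lower bound: an adversary keeps a word w ∈ {0,1}ⁿ; it answers a query (i, j) about a still
-- unrevealed entry by w j and then flips w j. Fix any u, let A be the number of rows whose
-- revealed entries agree with u and E the Hamming distance of w and u. The potential A + (A ∸ E)
-- drops by at most one per query: if the answer agrees with u, E grows by one and A is unchanged;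
-- otherwise E shrinks by one and A by at most one. It starts at m + (m ∸ E) ≥ m + (m ∸ n), and
-- when Cantor outputs u it must be 0, because a row consistent with the answers could equal u.
--
-- Upper bound: Cantor fixes his output bit by bit. With a < 2^(b+1) rows still to be avoided and
-- b+1 free bits, he asks the first free bit of 2x+1 of these rows, x = a ∸ 2^b, and outputs the
-- minority answer there; the rows that gave the majority answer are avoided, leaving at most
-- a ∸ (x+1) < 2^b rows. Since 2x+1 + cost(b, a ∸ (x+1)) = cost(b+1, a) for cost(n, m) = m + (m ∸ n),
-- induction gives cost(n, m) queries.

module Submission where

open import Defs
open import Data.Nat using (ℕ; zero; suc; _+_; _*_; _∸_; _^_; _≤_; _<_; z≤n; s≤s; _≤ᵇ_)
open import Data.Nat.Properties
open import Data.Bool using (Bool; true; false; not; _∧_; _xor_)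
import Data.Bool.Properties as Bool
open import Data.Maybe using (Maybe; just; nothing; fromMaybe)
open import Data.Fin using (Fin; zero; suc)
import Data.Fin.Properties as Fin
open import Data.Vec using (Vec; _∷_; lookup; tabulate; _[_]≔_)
import Data.Vec as Vec
open import Data.Vec.Properties using (lookup∘tabulate; lookup∘updateAt; lookup∘updateAt′; lookup-map)
open import Data.List using (List; []; _∷_)
import Data.List.Properties as List
open import Data.List.Membership.Propositional using (_∈_)
open import Data.List.Membership.Propositional.Properties using (∈-++⁺ˡ; ∈-++⁺ʳ; ∈-++⁻; ∈-allFin)
open import Data.List.Relation.Unary.Any using (here; there)
import Data.List as List
import Data.Vec.Functional as Vector
import Data.Vec.Functional.Properties as Vector
open import Data.Product using (∃; _×_; _,_; proj₁; proj₂)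
open import Data.Sum using (_⊎_; inj₁; inj₂)
open import Function using (_∘_; const; id)
open import Relation.Nullary using (yes; no; does; contradiction)
open import Relation.Nullary.Decidable using (dec-true)
open import Relation.Nullary.Reflects using (ofʸ; ofⁿ)
open import Relation.Binary.PropositionalEquality
open import Data.Nat.Tactic.RingSolver using (solve-∀)

cost : ℕ → ℕ → ℕ
cost n m = m + (m ∸ n)

m≤n⇒cost≡m : ∀ {n m} → m ≤ n → cost n m ≡ m
m≤n⇒cost≡m {n} {m} m≤n = trans (cong (m +_) (m≤n⇒m∸n≡0 m≤n)) (+-identityʳ m)

n≤m⇒cost≡2m∸n : ∀ {n m} → n ≤ m → cost n m ≡ 2 * m ∸ n
n≤m⇒cost≡2m∸n {n} {m} n≤m =
  trans (sym (+-∸-assoc m n≤m)) (cong (λ k → m + k ∸ n) (sym (+-identityʳ m)))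

cost-monoʳ-≤ : ∀ n {m m′} → m ≤ m′ → cost n m ≤ cost n m′
cost-monoʳ-≤ n m≤m′ = +-mono-≤ m≤m′ (∸-monoˡ-≤ n m≤m′)

cost-monoˡ-≥ : ∀ {n n′} m → n ≤ n′ → cost n′ m ≤ cost n m
cost-monoˡ-≥ m n≤n′ = +-monoʳ-≤ m (∸-monoʳ-≤ m n≤n′)

cost[n]≤1+cost[1+n] : ∀ n m → cost n m ≤ suc (cost (suc n) m)
cost[n]≤1+cost[1+n] n m = begin
  m + (m ∸ n)                ≤⟨ +-monoʳ-≤ m (m∸n≤suc[m∸suc[n]] m n) ⟩
  m + suc (m ∸ suc n)        ≡⟨ +-suc m _ ⟩
  suc (cost (suc n) m)       ∎
  where
  open ≤-Reasoning
  m∸n≤suc[m∸suc[n]] : ∀ m n → m ∸ n ≤ suc (m ∸ suc n)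
  m∸n≤suc[m∸suc[n]] zero    zero    = z≤n
  m∸n≤suc[m∸suc[n]] zero    (suc n) = z≤n
  m∸n≤suc[m∸suc[n]] (suc m) zero    = ≤-refl
  m∸n≤suc[m∸suc[n]] (suc m) (suc n) = m∸n≤suc[m∸suc[n]] m n

bit : Bool → ℕ
bit false = 0
bit true  = 1

count : ∀ {k} → (Fin k → Bool) → ℕ
count {zero}  p = 0
count {suc k} p = bit (p zero) + count (p ∘ suc)

every : ∀ {k} → (Fin k → Bool) → Bool
every {zero}  p = true
every {suc k} p = p zero ∧ every (p ∘ suc)

AgreeOff : ∀ {k} → Fin k → (Fin k → Bool) → (Fin k → Bool) → Set
AgreeOff i p q = ∀ x → x ≢ i → p x ≡ q x

count-cong : ∀ {k} {p q : Fin k → Bool} → (∀ x → p x ≡ q x) → count p ≡ count q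
count-cong {zero}  p≗q = refl
count-cong {suc k} p≗q = cong₂ _+_ (cong bit (p≗q zero)) (count-cong (p≗q ∘ suc))

count≤ : ∀ {k} (p : Fin k → Bool) → count p ≤ k
count≤ {zero}  p = z≤n
count≤ {suc k} p = +-mono-≤ (bit≤1 (p zero)) (count≤ (p ∘ suc))
  where
  bit≤1 : ∀ b → bit b ≤ 1
  bit≤1 false = z≤n
  bit≤1 true  = s≤s z≤n

count-all : ∀ {k} {p : Fin k → Bool} → (∀ x → p x ≡ true) → count p ≡ k
count-all {zero}  all = refl
count-all {suc k} all rewrite all zero = cong suc (count-all (all ∘ suc))

count-none : ∀ {k} {p : Fin k → Bool} → (∀ x → p x ≡ false) → count p ≡ 0
count-none {zero}  none = refl
count-none {suc k} none rewrite none zero = count-none (none ∘ suc)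

AgreeOff-suc : ∀ {k} {i : Fin k} {p q : Fin (suc k) → Bool} →
  AgreeOff (suc i) p q → AgreeOff i (p ∘ suc) (q ∘ suc)
AgreeOff-suc agree x x≢i = agree (suc x) (x≢i ∘ Fin.suc-injective)

count-raise : ∀ {k} {i : Fin k} {p q : Fin k → Bool} → AgreeOff i p q →
  p i ≡ false → q i ≡ true → count q ≡ suc (count p)
count-raise {i = zero} {p} {q} agree pi qi rewrite pi | qi =
  cong suc (sym (count-cong (λ x → agree (suc x) λ ())))
count-raise {i = suc i} {p} {q} agree pi qi rewrite agree zero (λ ()) =
  trans (cong (bit (q zero) +_) (count-raise (AgreeOff-suc agree) pi qi)) (+-suc _ _)

count≤1+count : ∀ {k} {i : Fin k} {p q : Fin k → Bool} → AgreeOff i p q →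
  count p ≤ suc (count q)
count≤1+count {i = zero} {p} {q} agree with p zero | q zero
... | false | _ rewrite count-cong (λ x → agree (suc x) λ ()) = ≤-trans (n≤1+n _) (s≤s (m≤n+m _ _))
... | true  | _ rewrite count-cong (λ x → agree (suc x) λ ()) = s≤s (m≤n+m _ _)
count≤1+count {i = suc i} {p} {q} agree rewrite agree zero (λ ()) =
  ≤-trans (+-monoʳ-≤ (bit (q zero)) (count≤1+count (AgreeOff-suc agree))) (≤-reflexive (+-suc _ _))

every-cong : ∀ {k} {p q : Fin k → Bool} → (∀ x → p x ≡ q x) → every p ≡ every q
every-cong {zero}  p≗q = refl
every-cong {suc k} p≗q = cong₂ _∧_ (p≗q zero) (every-cong (p≗q ∘ suc))

every-all : ∀ {k} {p : Fin k → Bool} → (∀ x → p x ≡ true) → every p ≡ true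
every-all {zero}  all = refl
every-all {suc k} all rewrite all zero = every-all (all ∘ suc)

every⇒all : ∀ {k} {p : Fin k → Bool} → every p ≡ true → ∀ x → p x ≡ true
every⇒all {suc k} {p} ev x with p zero in p0
every⇒all {suc k} {p} ev zero    | true = p0
every⇒all {suc k} {p} ev (suc x) | true = every⇒all ev x

-- The adversary

Knowledge : ℕ → ℕ → Set
Knowledge n m = Fin m → Fin n → Maybe Bool

ignorance : ∀ {n m} → Knowledge n m
ignorance _ _ = nothing

reveal : ∀ {n m} → Knowledge n m → Fin m → Fin n → Bool → Knowledge n m
reveal κ i j b = Vector.updateAt κ i (λ row → Vector.updateAt row j (const (just b)))

Consistent : ∀ {n m} → Knowledge n m → Instance n m → Set
Consistent κ vs = ∀ i j {b} → κ i j ≡ just b → answer vs i j ≡ b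

WinsFrom : ∀ {n m} → Knowledge n m → ℕ → Strategy n m → Set
WinsFrom κ q s = ∀ vs → Consistent κ vs →
  (queries s vs ≤ q) × (∀ i → result s vs ≢ lookup vs i)

module _ {n m} (κ : Knowledge n m) (i : Fin m) (j : Fin n) (b : Bool) where

  reveal-revealed : reveal κ i j b i j ≡ just b
  reveal-revealed = trans (cong-app (Vector.updateAt-updates i κ) j) (Vector.updateAt-updates j (κ i))

  reveal-otherRow : ∀ {i′} → i′ ≢ i → ∀ j′ → reveal κ i j b i′ j′ ≡ κ i′ j′
  reveal-otherRow i′≢i = cong-app (Vector.updateAt-minimal _ i κ i′≢i)

  reveal-otherColumn : ∀ {j′} → j′ ≢ j → reveal κ i j b i j′ ≡ κ i j′
  reveal-otherColumn j′≢j =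
    trans (cong-app (Vector.updateAt-updates i κ) _) (Vector.updateAt-minimal _ j (κ i) j′≢j)

  reveal-preserves : κ i j ≡ nothing →
    ∀ i′ j′ {b′} → κ i′ j′ ≡ just b′ → reveal κ i j b i′ j′ ≡ just b′
  reveal-preserves unknown i′ j′ known with i′ Fin.≟ i | j′ Fin.≟ j
  ... | no i′≢i    | _         = trans (reveal-otherRow i′≢i j′) known
  ... | yes refl   | no j′≢j   = trans (reveal-otherColumn j′≢j) known
  ... | yes refl   | yes refl  = contradiction (trans (sym unknown) known) λ ()

agrees : Maybe Bool → Bool → Bool
agrees nothing  _ = true
agrees (just a) b = does (a Bool.≟ b)

survives : ∀ {n m} → Knowledge n m → Vec Bool n → Fin m → Bool
survives κ u i = every (λ j → agrees (κ i j) (lookup u j))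

survivors : ∀ {n m} → Knowledge n m → Vec Bool n → ℕ
survivors κ u = count (survives κ u)

mismatches : ∀ {n} → (Fin n → Bool) → Vec Bool n → ℕ
mismatches w u = count (λ j → w j xor lookup u j)

survivors-ignorance : ∀ {n m} (u : Vec Bool n) → survivors (ignorance {n} {m}) u ≡ m
survivors-ignorance {n} u = count-all (λ _ → every-all {n} (λ _ → refl))

survivors-reveal : ∀ {n m} (κ : Knowledge n m) i j b u →
  survivors κ u ≤ suc (survivors (reveal κ i j b) u)
survivors-reveal κ i j b u = count≤1+count {i = i} λ i′ i′≢i →
  every-cong λ j′ → cong (λ a → agrees a (lookup u j′)) (sym (reveal-otherRow κ i j b i′≢i j′))

survivors-reveal-agreeing : ∀ {n m} (κ : Knowledge n m) i j b u →
  κ i j ≡ nothing → b ≡ lookup u j → survivors (reveal κ i j b) u ≡ survivors κ u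
survivors-reveal-agreeing κ i j b u unknown b≡uj = count-cong λ i′ → every-cong (agree i′)
  where
  agree : ∀ i′ j′ → agrees (reveal κ i j b i′ j′) (lookup u j′) ≡ agrees (κ i′ j′) (lookup u j′)
  agree i′ j′ with i′ Fin.≟ i | j′ Fin.≟ j
  ... | no i′≢i  | _        = cong (λ a → agrees a (lookup u j′)) (reveal-otherRow κ i j b i′≢i j′)
  ... | yes refl | no j′≢j  = cong (λ a → agrees a (lookup u j′)) (reveal-otherColumn κ i j b j′≢j)
  ... | yes refl | yes refl rewrite reveal-revealed κ i j b | unknown | b≡uj =
    dec-true (lookup u j Bool.≟ lookup u j) refl

flip : ∀ {n} → (Fin n → Bool) → Fin n → Fin n → Bool
flip w j = Vector.updateAt w j not

module _ {n} (w : Fin n → Bool) (j : Fin n) (u : Vec Bool n) where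

  private
    mismatch : (Fin n → Bool) → Fin n → Bool
    mismatch w′ j′ = w′ j′ xor lookup u j′

    flip-agreeOff : AgreeOff j (mismatch w) (mismatch (flip w j))
    flip-agreeOff j′ j′≢j = cong (_xor lookup u j′) (sym (Vector.updateAt-minimal j′ j w j′≢j))

    flip-toggles : mismatch (flip w j) j ≡ not (mismatch w j)
    flip-toggles = trans (cong (_xor lookup u j) (Vector.updateAt-updates j w))
                         (sym (Bool.not-distribˡ-xor (w j) (lookup u j)))

  mismatches-flip-agreeing : w j ≡ lookup u j → mismatches (flip w j) u ≡ suc (mismatches w u)
  mismatches-flip-agreeing wj≡uj = count-raise flip-agreeOff agree (trans flip-toggles (cong not agree))
    where
    agree : mismatch w j ≡ false
    agree = trans (cong (_xor lookup u j) wj≡uj) (Bool.xor-same (lookup u j))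

  mismatches-flip-disagreeing : w j ≢ lookup u j → mismatches w u ≡ suc (mismatches (flip w j) u)
  mismatches-flip-disagreeing wj≢uj =
    count-raise (λ j′ j′≢j → sym (flip-agreeOff j′ j′≢j))
                (trans flip-toggles (cong not disagree)) disagree
    where
    xor-≢ : ∀ {x y} → x ≢ y → x xor y ≡ true
    xor-≢ {false} {false} x≢y = contradiction refl x≢y
    xor-≢ {false} {true}  _   = refl
    xor-≢ {true}  {false} _   = refl
    xor-≢ {true}  {true}  x≢y = contradiction refl x≢y

    disagree : mismatch w j ≡ true
    disagree = xor-≢ wj≢uj

potential : ∀ {n m} → Knowledge n m → (Fin n → Bool) → Vec Bool n → ℕ
potential κ w u = cost (mismatches w u) (survivors κ u)

potential-reveal : ∀ {n m} (κ : Knowledge n m) (w : Fin n → Bool) i j u → κ i j ≡ nothing →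
  potential κ w u ≤ suc (potential (reveal κ i j (w j)) (flip w j) u)
potential-reveal κ w i j u unknown with w j Bool.≟ lookup u j
... | yes wj≡uj
  rewrite mismatches-flip-agreeing w j u wj≡uj
        | survivors-reveal-agreeing κ i j (w j) u unknown wj≡uj
        = cost[n]≤1+cost[1+n] (mismatches w u) (survivors κ u)
... | no wj≢uj
  rewrite mismatches-flip-disagreeing w j u wj≢uj
        = cost-monoʳ-≤ (suc (mismatches (flip w j) u)) (survivors-reveal κ i j (w j) u)

completion : ∀ {n m} → Knowledge n m → Instance n m
completion κ = tabulate λ i → tabulate λ j → fromMaybe false (κ i j)

answer-completion : ∀ {n m} (κ : Knowledge n m) i j → answer (completion κ) i j ≡ fromMaybe false (κ i j)
answer-completion κ i j rewrite lookup∘tabulate (λ i → tabulate λ j → fromMaybe false (κ i j)) i =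
  lookup∘tabulate _ j

completion-consistent : ∀ {n m} (κ : Knowledge n m) → Consistent κ (completion κ)
completion-consistent κ i j known rewrite answer-completion κ i j | known = refl

agrees⇒≡ : ∀ {a b} → agrees (just a) b ≡ true → a ≡ b
agrees⇒≡ {a} {b} ok with a Bool.≟ b
... | yes a≡b = a≡b

survivor-consistent : ∀ {n m} (κ : Knowledge n m) u i → survives κ u i ≡ true →
  Consistent κ (completion κ [ i ]≔ u)
survivor-consistent κ u i alive i′ j known with i′ Fin.≟ i
... | yes refl rewrite lookup∘updateAt i {const u} (completion κ) =
  sym (agrees⇒≡ (trans (cong (λ a → agrees a (lookup u j)) (sym known)) (every⇒all alive j)))
... | no i′≢i rewrite lookup∘updateAt′ i′ i {const u} i′≢i (completion κ) =
  completion-consistent κ i′ j known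

winsFrom-ask : ∀ {n m} {κ κ′ : Knowledge n m} {q i j k b} → WinsFrom κ (suc q) (ask i j k) →
  (∀ vs → Consistent κ′ vs → Consistent κ vs × answer vs i j ≡ b) → WinsFrom κ′ q (k b)
winsFrom-ask wins sound vs consistent with sound vs consistent
... | c , refl with wins vs c
... | s≤s bound , avoids = bound , avoids

adversary : ∀ {n m} (s : Strategy n m) (κ : Knowledge n m) (w : Fin n → Bool) {q} →
  WinsFrom κ q s → ∃ λ u → potential κ w u ≤ q
adversary (output u) κ w wins = u , ≤-trans (≤-reflexive nothing-left) z≤n
  where
  dead : ∀ i → survives κ u i ≡ false
  dead i with survives κ u i in alive
  ... | false = refl
  ... | true  = contradiction (sym (lookup∘updateAt i (completion κ)))
                              (proj₂ (wins (completion κ [ i ]≔ u) (survivor-consistent κ u i alive)) i)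

  nothing-left : potential κ w u ≡ 0
  nothing-left rewrite count-none dead = 0∸n≡0 (mismatches w u)
adversary (ask i j k) κ w {zero} wins with proj₁ (wins (completion κ) (completion-consistent κ))
... | ()
adversary (ask i j k) κ w {suc q} wins with κ i j in known
... | just b  = let u , bound = adversary (k b) κ w (winsFrom-ask {k = k} wins λ vs c → c , c i j known)
                in u , m≤n⇒m≤1+n bound
... | nothing = let u , bound = adversary (k (w j)) (reveal κ i j (w j)) (flip w j) (winsFrom-ask {k = k} wins sound)
                in u , ≤-trans (potential-reveal κ w i j u known) (s≤s bound)
  where
  sound : ∀ vs → Consistent (reveal κ i j (w j)) vs → Consistent κ vs × answer vs i j ≡ w j
  sound vs c = (λ i′ j′ known′ → c i′ j′ (reveal-preserves κ i j (w j) known i′ j′ known′))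
             , c i j (reveal-revealed κ i j (w j))

lower-bound : ∀ {n m q} → Solvable n m q → cost n m ≤ q
lower-bound {n} {m} {q} (s , wins) with adversary s (ignorance {n} {m}) (const false) (λ vs _ → wins vs)
... | u , bound = begin
  cost n m                                      ≤⟨ cost-monoˡ-≥ m (count≤ (λ j → false xor lookup u j)) ⟩
  cost E m                                      ≡⟨ cong (cost E) (sym (survivors-ignorance {m = m} u)) ⟩
  potential (ignorance {n} {m}) (const false) u ≤⟨ bound ⟩
  q                                             ∎
  where
  open ≤-Reasoning
  E = mismatches (const false) u

-- Cantor's strategy

tails : ∀ {b m} → Instance (suc b) m → Instance b m
tails = Vec.map Vec.tail

answer-tails : ∀ {b m} (vs : Instance (suc b) m) i j → answer vs i (suc j) ≡ answer (tails vs) i j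
answer-tails vs i j rewrite lookup-map i Vec.tail vs with lookup vs i
... | _ ∷ _ = refl

prefix : ∀ {b m} → Bool → Strategy b m → Strategy (suc b) m
prefix c (output u)  = output (c ∷ u)
prefix c (ask i j k) = ask i (suc j) (prefix c ∘ k)

queries-prefix : ∀ {b m} c (s : Strategy b m) vs → queries (prefix c s) vs ≡ queries s (tails vs)
queries-prefix c (output u)  vs = refl
queries-prefix c (ask i j k) vs rewrite answer-tails vs i j = cong suc (queries-prefix c (k _) vs)

result-prefix : ∀ {b m} c (s : Strategy b m) vs → result (prefix c s) vs ≡ c ∷ result s (tails vs)
result-prefix c (output u)  vs = refl
result-prefix c (ask i j k) vs rewrite answer-tails vs i j = result-prefix c (k _) vs

Answers : ℕ → Set
Answers m = List (Fin m × Bool)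

queryColumn : ∀ {n m} → Fin n → List (Fin m) → (Answers m → Strategy n m) → Strategy n m
queryColumn j []       k = k []
queryColumn j (i ∷ is) k = ask i j λ a → queryColumn j is (k ∘ ((i , a) ∷_))

column : ∀ {n m} → Instance n m → Fin n → List (Fin m) → Answers m
column vs j = List.map λ i → i , answer vs i j

queries-queryColumn : ∀ {n m} j is k (vs : Instance n m) →
  queries (queryColumn j is k) vs ≡ List.length is + queries (k (column vs j is)) vs
queries-queryColumn j []       k vs = refl
queries-queryColumn j (i ∷ is) k vs = cong suc (queries-queryColumn j is _ vs)

result-queryColumn : ∀ {n m} j is k (vs : Instance n m) →
  result (queryColumn j is k) vs ≡ result (k (column vs j is)) vs
result-queryColumn j []       k vs = refl
result-queryColumn j (i ∷ is) k vs = result-queryColumn j is _ vs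

rowsAnswering : ∀ {m} → Bool → Answers m → List (Fin m)
rowsAnswering c []            = []
rowsAnswering c ((i , a) ∷ r) with does (a Bool.≟ c)
... | true  = i ∷ rowsAnswering c r
... | false = rowsAnswering c r

length-rowsAnswering : ∀ {m} c (r : Answers m) →
  List.length (rowsAnswering c r) + List.length (rowsAnswering (not c) r) ≡ List.length r
length-rowsAnswering c []            = refl
length-rowsAnswering c ((i , a) ∷ r) with a | c
... | true  | true  = cong suc (length-rowsAnswering true r)
... | false | false = cong suc (length-rowsAnswering false r)
... | true  | false = trans (+-suc _ _) (cong suc (length-rowsAnswering false r))
... | false | true  = trans (+-suc _ _) (cong suc (length-rowsAnswering true r))

∈-rowsAnswering : ∀ {n m} (vs : Instance n m) j c {is i} → i ∈ is → answer vs i j ≡ c →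
  i ∈ rowsAnswering c (column vs j is)
∈-rowsAnswering vs j c {i′ ∷ is} i∈ ans with answer vs i′ j Bool.≟ c | i∈
... | yes _    | here refl = here refl
... | no ans≢c | here refl = contradiction ans ans≢c
... | yes _    | there i∈is = there (∈-rowsAnswering vs j c i∈is ans)
... | no _     | there i∈is = ∈-rowsAnswering vs j c i∈is ans

minority : ∀ {m} → Answers m → Bool
minority r = List.length (rowsAnswering true r) ≤ᵇ List.length (rowsAnswering false r)

minority-≤ : ∀ {m} (r : Answers m) →
  List.length (rowsAnswering (minority r) r) ≤ List.length (rowsAnswering (not (minority r)) r)
minority-≤ r with List.length (rowsAnswering true r) ≤ᵇ List.length (rowsAnswering false r)
                | ≤ᵇ-reflects-≤ (List.length (rowsAnswering true r)) (List.length (rowsAnswering false r))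
... | true  | ofʸ t≤f = t≤f
... | false | ofⁿ t≰f = <⇒≤ (≰⇒> t≰f)

m+m≤suc[n+n]⇒m≤n : ∀ {m n} → m + m ≤ suc (n + n) → m ≤ n
m+m≤suc[n+n]⇒m≤n {zero}          _        = z≤n
m+m≤suc[n+n]⇒m≤n {suc m} {zero}  (s≤s le) rewrite +-suc m m with le
... | ()
m+m≤suc[n+n]⇒m≤n {suc m} {suc n} (s≤s le) rewrite +-suc m m | +-suc n n =
  s≤s (m+m≤suc[n+n]⇒m≤n (≤-pred le))

length-rowsAnswering-minority : ∀ {m} x (r : Answers m) → List.length r ≡ suc (2 * x) →
  List.length (rowsAnswering (minority r) r) ≤ x
length-rowsAnswering-minority x r odd = m+m≤suc[n+n]⇒m≤n (begin
  a + a          ≤⟨ +-monoʳ-≤ a (minority-≤ r) ⟩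
  a + _          ≡⟨ length-rowsAnswering (minority r) r ⟩
  List.length r  ≡⟨ odd ⟩
  suc (2 * x)    ≡⟨ cong (λ y → suc (x + y)) (+-identityʳ x) ⟩
  suc (x + x)    ∎)
  where
  open ≤-Reasoning
  a = List.length (rowsAnswering (minority r) r)

excess-remaining : ∀ p x → x ≤ p → x + (suc p + x ∸ suc (2 * x)) ≡ p
excess-remaining p x x≤p = begin
    x + (p + x ∸ (x + (x + 0)))   ≡⟨ cong (λ y → x + (y ∸ (x + (x + 0)))) (+-comm p x) ⟩
    x + (x + p ∸ (x + (x + 0)))   ≡⟨ cong (x +_) ([m+n]∸[m+o]≡n∸o x p (x + 0)) ⟩
    x + (p ∸ (x + 0))             ≡⟨ cong (λ y → x + (p ∸ y)) (+-identityʳ x) ⟩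
    x + (p ∸ x)                   ≡⟨ m+[n∸m]≡n x≤p ⟩
    p                             ∎
  where open ≡-Reasoning

column-arith-excess : ∀ {a p x b} → a ≡ suc p + x → x ≤ p → b ≤ p →
  suc (2 * x) ≤ a ×
  x + (a ∸ suc (2 * x)) < suc p ×
  suc (2 * x) + cost b (x + (a ∸ suc (2 * x))) ≡ cost (suc b) a
column-arith-excess {p = p} {x} {b} refl x≤p b≤p rewrite excess-remaining p x x≤p =
  s≤s (≤-trans (≤-reflexive (cong (x +_) (+-identityʳ x))) (+-monoˡ-≤ x x≤p)) ,
  s≤s ≤-refl ,
  (begin
    suc (2 * x) + (p + (p ∸ b))      ≡⟨ reorder x p (p ∸ b) ⟩
    suc p + x + ((p ∸ b) + x)        ≡⟨ cong (suc p + x +_) (+-∸-comm x b≤p) ⟨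
    cost (suc b) (suc p + x)         ∎)
  where
  open ≡-Reasoning
  reorder : ∀ x p d → suc (2 * x) + (p + d) ≡ suc p + x + (d + x)
  reorder = solve-∀

column-arith : ∀ {a P b} → 0 < a → a < 2 * P → b < P →
  suc (2 * (a ∸ P)) ≤ a ×
  (a ∸ P) + (a ∸ suc (2 * (a ∸ P))) < P ×
  suc (2 * (a ∸ P)) + cost b ((a ∸ P) + (a ∸ suc (2 * (a ∸ P)))) ≡ cost (suc b) a
column-arith {suc a} {suc p} {b} _ a<2P (s≤s b≤p) with suc a ≤? suc p
... | yes a≤P rewrite m≤n⇒m∸n≡0 a≤P = s≤s z≤n , a≤P , refl
... | no  a≰P = column-arith-excess (sym (m+[n∸m]≡n P≤a)) x≤p b≤p
  where
  P≤a : suc p ≤ suc a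
  P≤a = <⇒≤ (≰⇒> a≰P)
  x≤p : a ∸ p ≤ p
  x≤p = subst (a ∸ p ≤_) (+-identityʳ p)
          (m≤n+o⇒m∸n≤o a p (≤-pred (subst (suc a ≤_) (+-suc p (p + 0)) (≤-pred a<2P))))

n<2^n : ∀ n → n < 2 ^ n
n<2^n zero    = s≤s z≤n
n<2^n (suc n) = +-mono-≤ (m^n>0 2 n) (≤-trans (n<2^n n) (m≤m+n _ 0))

nextRows : ∀ {m} → ℕ → List (Fin m) → Answers m → List (Fin m)
nextRows t L r = rowsAnswering (minority r) r List.++ List.drop t L

length-nextRows : ∀ {n m} (vs : Instance n m) j x (L : List (Fin m)) → suc (2 * x) ≤ List.length L →
  let t = suc (2 * x) in List.length (nextRows t L (column vs j (List.take t L))) ≤ x + (List.length L ∸ t)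
length-nextRows vs j x L t≤a = begin
  List.length (rowsAnswering c r List.++ List.drop t L)           ≡⟨ List.length-++ (rowsAnswering c r) ⟩
  List.length (rowsAnswering c r) + List.length (List.drop t L)
    ≤⟨ +-monoˡ-≤ _ (length-rowsAnswering-minority x r |r|) ⟩
  x + List.length (List.drop t L)                                 ≡⟨ cong (x +_) (List.length-drop t L) ⟩
  x + (List.length L ∸ t)                                         ∎
  where
  open ≤-Reasoning
  t = suc (2 * x)
  r = column vs j (List.take t L)
  c = minority r
  |r| : List.length r ≡ t
  |r| = trans (List.length-map _ (List.take t L)) (trans (List.length-take t L) (m≤n⇒m⊓n≡m t≤a))

nextRows-complete : ∀ {n m} (vs : Instance n m) j t (L : List (Fin m)) {i} → i ∈ L →
  let r = column vs j (List.take t L) in answer vs i j ≢ minority r ⊎ i ∈ nextRows t L r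
nextRows-complete vs j t L {i} i∈L
  with ∈-++⁻ (List.take t L) (subst (i ∈_) (sym (List.take++drop≡id t L)) i∈L)
... | inj₂ i∈drop = inj₂ (∈-++⁺ʳ _ i∈drop)
... | inj₁ i∈take with answer vs i j Bool.≟ minority (column vs j (List.take t L))
...   | yes ans≡c = inj₂ (∈-++⁺ˡ (∈-rowsAnswering vs j _ i∈take ans≡c))
...   | no  ans≢c = inj₁ ans≢c

cantor : ∀ {m} b → List (Fin m) → Strategy b m
cantor b       []          = output (Vec.replicate b false)
cantor zero    (_ ∷ _)     = output Vec.[]  -- unreachable: the list has length < 2 ^ 0
cantor (suc b) L@(_ ∷ _)   =
  queryColumn zero (List.take t L) λ r → prefix (minority r) (cantor b (nextRows t L r))
  where t = suc (2 * (List.length L ∸ 2 ^ b))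

∷-≢-head : ∀ {b} {c : Bool} {w : Vec Bool b} {v} → c ≢ lookup v zero → c ∷ w ≢ v
∷-≢-head c≢v₀ refl = c≢v₀ refl

∷-≢-tail : ∀ {b} {c : Bool} {w : Vec Bool b} {v} → w ≢ Vec.tail v → c ∷ w ≢ v
∷-≢-tail w≢tail refl = w≢tail refl

cantor-wins : ∀ {m} b (L : List (Fin m)) → List.length L < 2 ^ b → ∀ vs →
  queries (cantor b L) vs ≤ cost b (List.length L) ×
  (∀ i → i ∈ L → result (cantor b L) vs ≢ lookup vs i)
cantor-wins b       []        _        vs = z≤n , λ _ ()
cantor-wins zero    (_ ∷ _)   (s≤s ()) vs
cantor-wins (suc b) L@(_ ∷ _) L<2P     vs = queries-bound , avoids
  where
  a = List.length L
  x = a ∸ 2 ^ b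
  t = suc (2 * x)
  r = column vs zero (List.take t L)
  c = minority r
  L′ = nextRows t L r

  next : Answers _ → Strategy (suc b) _
  next r = prefix (minority r) (cantor b (nextRows t L r))

  arith = column-arith (s≤s z≤n) L<2P (n<2^n b)
  t≤a = proj₁ arith

  |L′|<P : List.length L′ < 2 ^ b
  |L′|<P = <-≤-trans (s≤s (length-nextRows vs zero x L t≤a)) (proj₁ (proj₂ arith))

  ih = cantor-wins b L′ |L′|<P (tails vs)

  queries-bound : queries (cantor (suc b) L) vs ≤ cost (suc b) a
  queries-bound = begin
    queries (cantor (suc b) L) vs                    ≡⟨ queries-queryColumn zero (List.take t L) next vs ⟩
    List.length (List.take t L) + queries (prefix c (cantor b L′)) vs
      ≡⟨ cong₂ _+_ (trans (List.length-take t L) (m≤n⇒m⊓n≡m t≤a)) (queries-prefix c (cantor b L′) vs) ⟩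
    t + queries (cantor b L′) (tails vs)             ≤⟨ +-monoʳ-≤ t (proj₁ ih) ⟩
    t + cost b (List.length L′)
      ≤⟨ +-monoʳ-≤ t (cost-monoʳ-≤ b (length-nextRows vs zero x L t≤a)) ⟩
    t + cost b (x + (a ∸ t))                         ≡⟨ proj₂ (proj₂ arith) ⟩
    cost (suc b) a                                   ∎
    where open ≤-Reasoning

  result-cons : result (cantor (suc b) L) vs ≡ c ∷ result (cantor b L′) (tails vs)
  result-cons = trans (result-queryColumn zero (List.take t L) next vs) (result-prefix c (cantor b L′) vs)

  avoids : ∀ i → i ∈ L → result (cantor (suc b) L) vs ≢ lookup vs i
  avoids i i∈L rewrite result-cons with nextRows-complete vs zero t L i∈L
  ... | inj₁ ans≢c = ∷-≢-head (ans≢c ∘ sym)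
  ... | inj₂ i∈L′  = ∷-≢-tail λ eq → proj₂ ih i i∈L′ (trans eq (sym (lookup-map i Vec.tail vs)))

upper-bound : ∀ n m → m < 2 ^ n → Solvable n m (cost n m)
upper-bound n m m<2^n = cantor n (List.allFin m) , wins
  where
  |allFin| : List.length (List.allFin m) ≡ m
  |allFin| = List.length-tabulate id

  wins : Wins (cost n m) (cantor n (List.allFin m))
  wins vs with cantor-wins n (List.allFin m) (subst (_< 2 ^ n) (sym |allFin|) m<2^n) vs
  ... | bound , avoids =
    subst (λ k → queries (cantor n (List.allFin m)) vs ≤ cost n k) |allFin| bound ,
    λ i → avoids i (∈-allFin i)

theorem3p1 : (m n : ℕ) → 1 ≤ m → 1 ≤ n → m < 2 ^ n →
    (m ≤ n → IsG n m m) × (n < m → IsG n m (2 * m ∸ n))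
theorem3p1 m n _ _ m<2^n =
    (λ m≤n → subst (IsG n m) (m≤n⇒cost≡m m≤n) g≡cost)
  , (λ n<m → subst (IsG n m) (n≤m⇒cost≡2m∸n (<⇒≤ n<m)) g≡cost)
  where
  g≡cost : IsG n m (cost n m)
  g≡cost = upper-bound n m m<2^n , λ _ → lower-bound
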